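{- For $i=1,2$ let $G_i^{x_i}$ be a bridgeless cubic graph with distinguished vertex $x_i$ whose neighbours are $a_i,b_i,c_i$, let $G_i=G_i^{x_i}-x_i$, and assume $\tau(G_i^{x_i})\ge 5$ and $\tau_{odd}(G_i^{x_i})\neq 5$ (i.e. it is not the case that $G_i^{x_i}$ has an odd covering whose minimum size is $5$). Let $G$ be the cubic graph obtained from $G_1\cup G_2$ by adding two new vertices $x,y$ and the edges $c_1c_2,\ a_1y,\ a_2y,\ b_1x,\ b_2x,\ xy$. Then $\tau(G)\ge 5$, and if $G$ has an odd covering then $\tau_{odd}(G)\neq 5$.
   Context: For a bridgeless cubic graph $H$, $\tau(H)$ is the minimum number of perfect matchings of $H$ whose union is $E(H)$. An odd covering of $H$ is a finite list (repetitions allowed) of perfect matchings of $H$ such that every edge is contained in an odd number of members of the list; its size is the number of members, and $\tau_{odd}(H)$ denotes the minimum size of an odd covering of $H$ (defined when $H$ has one). (This is the paper's construction $K_4[G_1^{x_1},G_2^{x_2},G_3^{y'},G_4^{x'}]$ in which $G_3^{y'}$ and $G_4^{x'}$ are copies of the cubic graph on two vertices, so the third and fourth pieces are single vertices $y$ and $x$.) -}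

module Defs where

open import Data.Nat using (ℕ; zero; suc; _≤_; _%_)
open import Data.Bool using (Bool; true; false; T)
open import Data.Product using (Σ; ∃; _×_; _,_)
open import Data.Sum using (_⊎_)
open import Data.List using (List; []; _∷_; length)
open import Data.List.Relation.Unary.All using (All)
open import Data.List.Relation.Unary.Any using (Any)
open import Data.List.Membership.Propositional using (_∈_)
open import Relation.Binary.PropositionalEquality using (_≡_; _≢_)
open import Relation.Binary.Definitions using (DecidableEquality)
open import Relation.Nullary using (¬_; yes; no)
open import Relation.Nullary.Decidable using (False; fromWitnessFalse)

-- Multigraphs (parallel edges allowed).  An edge e has two ends.
record Graph : Set₁ where
  field
    V    : Set
    E    : Set
    end₁ : E → V
    end₂ : E → V
open Graph public

record Finite (G : Graph) : Set where
  field
    decV     : DecidableEquality (V G)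
    decE     : DecidableEquality (E G)
    vertices : List (V G)
    allV     : ∀ v → v ∈ vertices
    edges    : List (E G)
    allE     : ∀ e → e ∈ edges
open Finite public

module _ (G : Graph) where
  Incident : E G → V G → Set
  Incident e w = end₁ G e ≡ w ⊎ end₂ G e ≡ w

  Adjacent : V G → V G → Set
  Adjacent w z = Σ (E G) λ e →
    (end₁ G e ≡ w × end₂ G e ≡ z) ⊎ (end₁ G e ≡ z × end₂ G e ≡ w)

  Loopless : Set
  Loopless = ∀ e → end₁ G e ≢ end₂ G e

  Cubic : Set
  Cubic = Loopless × (∀ w → Σ (E G) λ e₁ → Σ (E G) λ e₂ → Σ (E G) λ e₃ →
            e₁ ≢ e₂ × e₁ ≢ e₃ × e₂ ≢ e₃ ×
            Incident e₁ w × Incident e₂ w × Incident e₃ w ×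
            (∀ f → Incident f w → f ≡ e₁ ⊎ f ≡ e₂ ⊎ f ≡ e₃))

  data Reach (e : E G) : V G → V G → Set where
    here : ∀ {w} → Reach e w w
    fwd  : ∀ {w} f → f ≢ e → Reach e (end₂ G f) w → Reach e (end₁ G f) w
    bwd  : ∀ {w} f → f ≢ e → Reach e (end₁ G f) w → Reach e (end₂ G f) w

  Bridgeless : Set
  Bridgeless = ∀ e → Reach e (end₁ G e) (end₂ G e)

  IsPerfectMatching : (E G → Bool) → Set
  IsPerfectMatching M = ∀ w → Σ (E G) λ e →
    T (M e) × Incident e w × (∀ f → T (M f) → Incident f w → f ≡ e)

  PerfectMatching : Set
  PerfectMatching = Σ (E G → Bool) IsPerfectMatching

  count : E G → List PerfectMatching → ℕ
  count e [] = zero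
  count e ((M , _) ∷ Ms) with M e
  ... | true  = suc (count e Ms)
  ... | false = count e Ms

  IsCovering : List PerfectMatching → Set
  IsCovering Ms = ∀ e → Any (λ Mp → T (Σ.proj₁ Mp e)) Ms

  TauAtLeast5 : Set
  TauAtLeast5 = ∀ Ms → IsCovering Ms → 5 ≤ length Ms

  IsOddCovering : List PerfectMatching → Set
  IsOddCovering Ms = ∀ e → count e Ms % 2 ≡ 1

  HasOddCovering : Set
  HasOddCovering = Σ (List PerfectMatching) IsOddCovering

  TauOddIs5 : Set
  TauOddIs5 = (Σ (List PerfectMatching) λ Ms → IsOddCovering Ms × length Ms ≡ 5)
            × (∀ Ms → IsOddCovering Ms → 5 ≤ length Ms)

  -- the neighbours of x are exactly the three distinct vertices a, b, c
  -- (in a cubic graph, three distinct neighbours are all of them)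
  NeighboursAre : V G → V G → V G → V G → Set
  NeighboursAre x a b c =
    Adjacent x a × Adjacent x b × Adjacent x c × a ≢ b × a ≢ c × b ≢ c

data XY : Set where
  vx vy : XY

data NewEdge : Set where
  c₁c₂ a₁y a₂y b₁x b₂x xy : NewEdge

module Glue (G₁ G₂ : Graph)
            (dec₁ : DecidableEquality (V G₁)) (dec₂ : DecidableEquality (V G₂))
            (x₁ a₁ b₁ c₁ : V G₁) (x₂ a₂ b₂ c₂ : V G₂) where

  V₁⁻ : Set
  V₁⁻ = Σ (V G₁) λ v → False (dec₁ v x₁)
  V₂⁻ : Set
  V₂⁻ = Σ (V G₂) λ v → False (dec₂ v x₂)

  E₁⁻ : Set
  E₁⁻ = Σ (E G₁) λ e → False (dec₁ (end₁ G₁ e) x₁) × False (dec₁ (end₂ G₁ e) x₁)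
  E₂⁻ : Set
  E₂⁻ = Σ (E G₂) λ e → False (dec₂ (end₁ G₂ e) x₂) × False (dec₂ (end₂ G₂ e) x₂)

  Vert : Set
  Vert = V₁⁻ ⊎ V₂⁻ ⊎ XY

  Edge : Set
  Edge = E₁⁻ ⊎ E₂⁻ ⊎ NewEdge

  -- a vertex of G₁^{x₁} other than x₁, seen in G (only applied to
  -- a₁, b₁, c₁, which differ from x₁; the x₁ case is a dummy value)
  in₁ : V G₁ → Vert
  in₁ v with dec₁ v x₁
  ... | yes _ = _⊎_.inj₂ (_⊎_.inj₂ vx)
  ... | no p  = _⊎_.inj₁ (v , fromWitnessFalse p)

  in₂ : V G₂ → Vert
  in₂ v with dec₂ v x₂
  ... | yes _ = _⊎_.inj₂ (_⊎_.inj₂ vx)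
  ... | no p  = _⊎_.inj₂ (_⊎_.inj₁ (v , fromWitnessFalse p))

  X Y : Vert
  X = _⊎_.inj₂ (_⊎_.inj₂ vx)
  Y = _⊎_.inj₂ (_⊎_.inj₂ vy)

  e₁ e₂ : Edge → Vert
  e₁ (_⊎_.inj₁ (e , p , q)) = _⊎_.inj₁ (end₁ G₁ e , p)
  e₁ (_⊎_.inj₂ (_⊎_.inj₁ (e , p , q))) = _⊎_.inj₂ (_⊎_.inj₁ (end₁ G₂ e , p))
  e₁ (_⊎_.inj₂ (_⊎_.inj₂ c₁c₂)) = in₁ c₁
  e₁ (_⊎_.inj₂ (_⊎_.inj₂ a₁y)) = in₁ a₁
  e₁ (_⊎_.inj₂ (_⊎_.inj₂ a₂y)) = in₂ a₂
  e₁ (_⊎_.inj₂ (_⊎_.inj₂ b₁x)) = in₁ b₁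
  e₁ (_⊎_.inj₂ (_⊎_.inj₂ b₂x)) = in₂ b₂
  e₁ (_⊎_.inj₂ (_⊎_.inj₂ xy)) = X
  e₂ (_⊎_.inj₁ (e , p , q)) = _⊎_.inj₁ (end₂ G₁ e , q)
  e₂ (_⊎_.inj₂ (_⊎_.inj₁ (e , p , q))) = _⊎_.inj₂ (_⊎_.inj₁ (end₂ G₂ e , q))
  e₂ (_⊎_.inj₂ (_⊎_.inj₂ c₁c₂)) = in₂ c₂
  e₂ (_⊎_.inj₂ (_⊎_.inj₂ a₁y)) = Y
  e₂ (_⊎_.inj₂ (_⊎_.inj₂ a₂y)) = Y
  e₂ (_⊎_.inj₂ (_⊎_.inj₂ b₁x)) = X
  e₂ (_⊎_.inj₂ (_⊎_.inj₂ b₂x)) = X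
  e₂ (_⊎_.inj₂ (_⊎_.inj₂ xy)) = Y

  glued : Graph
  glued = record { V = Vert ; E = Edge ; end₁ = e₁ ; end₂ = e₂ }

glue : (G₁ G₂ : Graph) → Finite G₁ → Finite G₂ →
       V G₁ → V G₁ → V G₁ → V G₁ → V G₂ → V G₂ → V G₂ → V G₂ → Graph
glue G₁ G₂ F₁ F₂ x₁ a₁ b₁ c₁ x₂ a₂ b₂ c₂ =
  Glue.glued G₁ G₂ (decV F₁) (decV F₂) x₁ a₁ b₁ c₁ x₂ a₂ b₂ c₂

-- Each side G_i − x_i sits in G behind the 3-edge cut {a_i y, b_i x, c₁c₂}.  A parity
-- (handshake) argument shows that every perfect matching of G meets such a cut once or three
-- times, and one meeting it once restricts to a perfect matching of G_i^{x_i}.  Hence a covering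
-- of G in which no matching is "full" on side i (uses the whole cut) restricts to a covering of
-- G_i^{x_i} of the same size.  Otherwise both sides have full matchings; the full matchings of
-- either side and the matchings through xy all contain c₁c₂ and are pairwise different, so c₁c₂
-- lies in at least 3 of them, and two more matchings are needed at c₁: at least 5 in total.
-- For an odd covering of size 5, a second parity argument (with halved edge counts) shows that
-- each side has evenly many, so at least 2, full matchings; then c₁c₂ lies in 5 of them and 7
-- matchings would be needed.
module Submission where

open import Defs
open import Algebra.Bundles using (CommutativeSemiring)
open import Data.Bool using (Bool; true; false; T; _∧_)
open import Data.Bool.Properties using (T-irrelevant)
open import Data.Empty using (⊥-elim)
open import Data.List using (List; []; _∷_; length; deduplicate)
open import Data.List.Membership.Propositional using (_∈_)
open import Data.List.Membership.Propositional.Properties using (∈-deduplicate⁺)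
import Data.List.Relation.Unary.All as All
open import Data.List.Relation.Unary.Any using (Any; here; there)
open import Data.List.Relation.Unary.AllPairs using (_∷_)
open import Data.List.Relation.Unary.Unique.Propositional using (Unique)
import Data.List.Relation.Unary.Unique.DecPropositional.Properties as UniqueDec
open import Data.Nat as ℕ using (ℕ; zero; suc; _≤_; z≤n; s≤s; parity; ⌊_/2⌋)
import Data.Nat.Properties as ℕₚ
open import Data.Nat.Tactic.RingSolver using (solve-∀)
open import Data.Parity as ℙ using (Parity; 0ℙ; 1ℙ; _⁻¹)
import Data.Parity.Properties as ℙₚ
open import Data.Product using (Σ; _×_; _,_; proj₁; proj₂)
open import Data.Sum using (_⊎_; inj₁; inj₂)
open import Data.Sum.Properties using (inj₁-injective; inj₂-injective)
open import Data.Unit using (tt)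
open import Function using (_∘_)
open import Relation.Binary.Definitions using (DecidableEquality)
open import Relation.Binary.PropositionalEquality using (_≡_; _≢_; refl; sym; trans; cong; cong₂; subst; subst₂; module ≡-Reasoning)
open import Relation.Nullary using (¬_; Dec; yes; no)
open import Relation.Nullary.Decidable using (False; fromWitnessFalse; toWitnessFalse)

module ListSum {c ℓ} (R : CommutativeSemiring c ℓ) where
  open CommutativeSemiring R renaming (refl to ≈-refl; sym to ≈-sym; trans to ≈-trans)
  open import Algebra.Properties.CommutativeSemigroup +-commutativeSemigroup using (interchange)
  open import Relation.Binary.Reasoning.Setoid setoid

  Σ⟨_⟩ : {A : Set} → List A → (A → Carrier) → Carrier
  Σ⟨ [] ⟩ f = 0#
  Σ⟨ a ∷ as ⟩ f = f a + Σ⟨ as ⟩ f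

  sum-cong : {A : Set} (L : List A) {f g : A → Carrier} → (∀ a → f a ≈ g a) → Σ⟨ L ⟩ f ≈ Σ⟨ L ⟩ g
  sum-cong [] eq = ≈-refl
  sum-cong (a ∷ L) eq = +-cong (eq a) (sum-cong L eq)

  sum-+ : {A : Set} (L : List A) (f g : A → Carrier) → Σ⟨ L ⟩ (λ a → f a + g a) ≈ Σ⟨ L ⟩ f + Σ⟨ L ⟩ g
  sum-+ [] f g = ≈-sym (+-identityˡ 0#)
  sum-+ (a ∷ L) f g = begin
    (f a + g a) + Σ⟨ L ⟩ (λ a → f a + g a) ≈⟨ +-congˡ (sum-+ L f g) ⟩
    (f a + g a) + (Σ⟨ L ⟩ f + Σ⟨ L ⟩ g)   ≈⟨ interchange (f a) (g a) _ _ ⟩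
    (f a + Σ⟨ L ⟩ f) + (g a + Σ⟨ L ⟩ g)   ∎

  sum-+₃ : {A : Set} (L : List A) (f g h : A → Carrier) →
           Σ⟨ L ⟩ (λ a → f a + g a + h a) ≈ Σ⟨ L ⟩ f + Σ⟨ L ⟩ g + Σ⟨ L ⟩ h
  sum-+₃ L f g h = ≈-trans (sum-+ L (λ a → f a + g a) h) (+-congʳ (sum-+ L f g))

  sum-*ˡ : {A : Set} (L : List A) (r : Carrier) (f : A → Carrier) → Σ⟨ L ⟩ (λ a → r * f a) ≈ r * Σ⟨ L ⟩ f
  sum-*ˡ [] r f = ≈-sym (zeroʳ r)
  sum-*ˡ (a ∷ L) r f = ≈-trans (+-congˡ (sum-*ˡ L r f)) (≈-sym (distribˡ r (f a) _))

  sum-zero : {A : Set} (L : List A) {f : A → Carrier} → (∀ a → a ∈ L → f a ≈ 0#) → Σ⟨ L ⟩ f ≈ 0#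
  sum-zero [] z = ≈-refl
  sum-zero (a ∷ L) z = ≈-trans (+-cong (z a (here refl)) (sum-zero L (λ b b∈L → z b (there b∈L)))) (+-identityˡ 0#)

  sum-swap : {A B : Set} (L : List A) (K : List B) (F : A → B → Carrier) →
             Σ⟨ L ⟩ (λ a → Σ⟨ K ⟩ (F a)) ≈ Σ⟨ K ⟩ (λ b → Σ⟨ L ⟩ (λ a → F a b))
  sum-swap [] K F = ≈-sym (sum-zero K (λ _ _ → ≈-refl))
  sum-swap (a ∷ L) K F = ≈-trans (+-congˡ (sum-swap L K F)) (≈-sym (sum-+ K (F a) _))

  sum-single : {A : Set} {L : List A} {x : A} {f : A → Carrier} → Unique L → x ∈ L →
               (∀ v → v ≢ x → f v ≈ 0#) → Σ⟨ L ⟩ f ≈ f x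
  sum-single {L = _ ∷ L} (x≢ ∷ _) (here refl) off =
    ≈-trans (+-congˡ (sum-zero L (λ v v∈L → off v (λ v≡x → All.lookup x≢ v∈L (sym v≡x))))) (+-identityʳ _)
  sum-single {L = v ∷ L} (v≢ ∷ unique) (there x∈L) off =
    ≈-trans (+-cong (off v (λ v≡x → All.lookup v≢ x∈L v≡x)) (sum-single unique x∈L off)) (+-identityˡ _)

open ListSum ℕₚ.+-*-commutativeSemiring using ()
  renaming (Σ⟨_⟩ to Σℕ⟨_⟩; sum-cong to Σℕ-cong; sum-+ to Σℕ-+; sum-+₃ to Σℕ-+₃; sum-*ˡ to Σℕ-*ˡ)

Σℕ-ones : {A : Set} (L : List A) → Σℕ⟨ L ⟩ (λ _ → 1) ≡ length L
Σℕ-ones [] = refl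
Σℕ-ones (_ ∷ L) = cong suc (Σℕ-ones L)

Σℕ-mono : {A : Set} (L : List A) {f g : A → ℕ} → (∀ a → f a ≤ g a) → Σℕ⟨ L ⟩ f ≤ Σℕ⟨ L ⟩ g
Σℕ-mono [] le = z≤n
Σℕ-mono (a ∷ L) le = ℕₚ.+-mono-≤ (le a) (Σℕ-mono L le)

open ListSum ℙₚ.+-*-commutativeSemiring using ()
  renaming (Σ⟨_⟩ to Σℙ⟨_⟩; sum-cong to Σℙ-cong; sum-+ to Σℙ-+; sum-+₃ to Σℙ-+₃; sum-*ˡ to Σℙ-*ˡ;
            sum-zero to Σℙ-zero; sum-swap to Σℙ-swap; sum-single to Σℙ-single)

holds : {P : Set} → Dec P → Parity
holds (yes _) = 1ℙ
holds (no _) = 0ℙ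

Σℙ-point : {A : Set} (_≟_ : DecidableEquality A) {L : List A} → Unique L → ∀ {h} → h ∈ L →
           (W : A → Parity) → Σℙ⟨ L ⟩ (λ e → W e ℙ.* holds (h ≟ e)) ≡ W h
Σℙ-point _≟_ unique {h} h∈L W = trans (Σℙ-single unique h∈L off) on
  where
  off : ∀ e → e ≢ h → W e ℙ.* holds (h ≟ e) ≡ 0ℙ
  off e e≢h with h ≟ e
  ... | yes h≡e = ⊥-elim (e≢h (sym h≡e))
  ... | no _ = ℙₚ.*-zeroʳ (W e)
  on : W h ℙ.* holds (h ≟ h) ≡ W h
  on with h ≟ h
  ... | yes _ = ℙₚ.*-identityʳ (W h)
  ... | no h≢h = ⊥-elim (h≢h refl)

odd-mod : ∀ n → n ℕ.% 2 ≡ 1 → parity n ≡ 1ℙ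
odd-mod zero ()
odd-mod (suc zero) _ = refl
odd-mod (suc (suc n)) odd = odd-mod n odd

odd-split : ∀ n → parity n ≡ 1ℙ → n ≡ suc (2 ℕ.* ⌊ n /2⌋)
odd-split zero ()
odd-split (suc zero) _ = refl
odd-split (suc (suc n)) odd =
  trans (cong (λ m → suc (suc m)) (odd-split n odd)) (cong suc (sym (ℕₚ.*-suc 2 ⌊ n /2⌋)))

parity₃ : ∀ a b c → parity (a ℕ.+ b ℕ.+ c) ≡ parity a ℙ.+ parity b ℙ.+ parity c
parity₃ a b c = trans (ℙₚ.+-homo-+ (a ℕ.+ b) c) (cong (ℙ._+ parity c) (ℙₚ.+-homo-+ a b))

odd-triple : ∀ a b c n → parity a ≡ 1ℙ → parity b ≡ 1ℙ → parity c ≡ 1ℙ → a ℕ.+ b ℕ.+ c ≡ 5 ℕ.+ 2 ℕ.* n →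
             ⌊ a /2⌋ ℕ.+ ⌊ b /2⌋ ℕ.+ ⌊ c /2⌋ ≡ suc n
odd-triple a b c n odd-a odd-b odd-c sum =
  ℕₚ.*-cancelˡ-≡ _ _ 2 (ℕₚ.suc-injective (ℕₚ.suc-injective (ℕₚ.suc-injective (begin
  3 ℕ.+ 2 ℕ.* (⌊ a /2⌋ ℕ.+ ⌊ b /2⌋ ℕ.+ ⌊ c /2⌋)  ≡⟨ regroup ⌊ a /2⌋ ⌊ b /2⌋ ⌊ c /2⌋ ⟩
  suc (2 ℕ.* ⌊ a /2⌋) ℕ.+ suc (2 ℕ.* ⌊ b /2⌋) ℕ.+ suc (2 ℕ.* ⌊ c /2⌋)
    ≡⟨ sym (cong₂ ℕ._+_ (cong₂ ℕ._+_ (odd-split a odd-a) (odd-split b odd-b)) (odd-split c odd-c)) ⟩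
  a ℕ.+ b ℕ.+ c                                 ≡⟨ sum ⟩
  5 ℕ.+ 2 ℕ.* n                                 ≡⟨ cong (3 ℕ.+_) (sym (ℕₚ.*-suc 2 n)) ⟩
  3 ℕ.+ 2 ℕ.* suc n                             ∎))))
  where
  open ≡-Reasoning
  regroup : ∀ p q r → 3 ℕ.+ 2 ℕ.* (p ℕ.+ q ℕ.+ r) ≡ suc (2 ℕ.* p) ℕ.+ suc (2 ℕ.* q) ℕ.+ suc (2 ℕ.* r)
  regroup = solve-∀

ind : Bool → ℕ
ind true = 1
ind false = 0

data ExactlyOne : Bool → Bool → Bool → Set where
  first  : ExactlyOne true false false
  second : ExactlyOne false true false
  third  : ExactlyOne false false true

exactlyOne-sum : ∀ {a b c} → ExactlyOne a b c → ind a ℕ.+ ind b ℕ.+ ind c ≡ 1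
exactlyOne-sum first = refl
exactlyOne-sum second = refl
exactlyOne-sum third = refl

exactlyOne-odd : ∀ {a b c} → ExactlyOne a b c → parity (ind a) ℙ.+ parity (ind b) ℙ.+ parity (ind c) ≡ 1ℙ
exactlyOne-odd first = refl
exactlyOne-odd second = refl
exactlyOne-odd third = refl

data OddOfThree : Bool → Bool → Bool → Set where
  one : ∀ {a b c} → ExactlyOne a b c → OddOfThree a b c
  all : OddOfThree true true true

odd-view : ∀ a b c → parity (ind a) ℙ.+ parity (ind b) ℙ.+ parity (ind c) ≡ 1ℙ → OddOfThree a b c
odd-view true  true  true  _ = all
odd-view true  false false _ = one first
odd-view false true  false _ = one second
odd-view false false true  _ = one third
odd-view true  true  false ()
odd-view true  false true  ()
odd-view false true  true  ()
odd-view false false false ()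

odd-not-all : ∀ {a b c} → OddOfThree a b c → a ∧ b ≡ false → ExactlyOne a b c
odd-not-all (one o) _ = o
odd-not-all all ()

odd-weight : ∀ {a b c} → OddOfThree a b c → ind a ℕ.+ ind b ℕ.+ ind c ≡ 1 ℕ.+ 2 ℕ.* ind (a ∧ b)
odd-weight (one first) = refl
odd-weight (one second) = refl
odd-weight (one third) = refl
odd-weight all = refl

ind≡0 : ∀ {b} → ind b ≡ 0 → b ≡ false
ind≡0 {false} _ = refl

In3 : {A : Set} → A → A → A → A → Set
In3 f a b c = f ≡ a ⊎ f ≡ b ⊎ f ≡ c

In3-swap₁₂ : {A : Set} {f a b c : A} → In3 f a b c → In3 f b a c
In3-swap₁₂ (inj₁ p) = inj₂ (inj₁ p)
In3-swap₁₂ (inj₂ (inj₁ p)) = inj₁ p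
In3-swap₁₂ (inj₂ (inj₂ p)) = inj₂ (inj₂ p)

In3-swap₂₃ : {A : Set} {f a b c : A} → In3 f a b c → In3 f a c b
In3-swap₂₃ (inj₁ p) = inj₁ p
In3-swap₂₃ (inj₂ (inj₁ p)) = inj₂ (inj₂ p)
In3-swap₂₃ (inj₂ (inj₂ p)) = inj₂ (inj₁ p)

record IsStar (G : Graph) (w : V G) (h₁ h₂ h₃ : E G) : Set where
  field
    h₁≢h₂ : h₁ ≢ h₂
    h₁≢h₃ : h₁ ≢ h₃
    h₂≢h₃ : h₂ ≢ h₃
    at₁ : Incident G h₁ w
    at₂ : Incident G h₂ w
    at₃ : Incident G h₃ w
    only : ∀ f → Incident G f w → In3 f h₁ h₂ h₃

Star : (G : Graph) → V G → Set
Star G w = Σ (E G) λ h₁ → Σ (E G) λ h₂ → Σ (E G) λ h₃ → IsStar G w h₁ h₂ h₃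

module _ {G : Graph} where

  cubic-star : Cubic G → ∀ w → Star G w
  cubic-star (_ , stars) w with stars w
  ... | h₁ , h₂ , h₃ , d₁₂ , d₁₃ , d₂₃ , i₁ , i₂ , i₃ , only =
    h₁ , h₂ , h₃ , record { h₁≢h₂ = d₁₂ ; h₁≢h₃ = d₁₃ ; h₂≢h₃ = d₂₃
                          ; at₁ = i₁ ; at₂ = i₂ ; at₃ = i₃ ; only = only }

  star-swap₁₂ : ∀ {w h₁ h₂ h₃} → IsStar G w h₁ h₂ h₃ → IsStar G w h₂ h₁ h₃
  star-swap₁₂ s = record { h₁≢h₂ = λ p → h₁≢h₂ (sym p) ; h₁≢h₃ = h₂≢h₃ ; h₂≢h₃ = h₁≢h₃
                         ; at₁ = at₂ ; at₂ = at₁ ; at₃ = at₃ ; only = λ f i → In3-swap₁₂ (only f i) }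
    where open IsStar s

  star-swap₂₃ : ∀ {w h₁ h₂ h₃} → IsStar G w h₁ h₂ h₃ → IsStar G w h₁ h₃ h₂
  star-swap₂₃ s = record { h₁≢h₂ = h₁≢h₃ ; h₁≢h₃ = h₁≢h₂ ; h₂≢h₃ = λ p → h₂≢h₃ (sym p)
                         ; at₁ = at₁ ; at₂ = at₃ ; at₃ = at₂ ; only = λ f i → In3-swap₂₃ (only f i) }
    where open IsStar s

  star-focus : ∀ {w h₁ h₂ h₃ f} → IsStar G w h₁ h₂ h₃ → In3 f h₁ h₂ h₃ → Σ (E G) λ g₂ → Σ (E G) λ g₃ → IsStar G w f g₂ g₃
  star-focus s (inj₁ refl) = _ , _ , s
  star-focus s (inj₂ (inj₁ refl)) = _ , _ , star-swap₁₂ s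
  star-focus s (inj₂ (inj₂ refl)) = _ , _ , star-swap₁₂ (star-swap₂₃ s)

  star-focus₂ : ∀ {w h₁ h₂ h₃ f} → IsStar G w h₁ h₂ h₃ → Incident G f w → f ≢ h₁ → Σ (E G) λ g → IsStar G w h₁ f g
  star-focus₂ s i f≢h₁ with IsStar.only s _ i
  ... | inj₁ f≡h₁ = ⊥-elim (f≢h₁ f≡h₁)
  ... | inj₂ (inj₁ refl) = _ , s
  ... | inj₂ (inj₂ refl) = _ , star-swap₂₃ s

  star-focus₃ : ∀ {w h₁ h₂ h₃ f} → IsStar G w h₁ h₂ h₃ → Incident G f w → f ≢ h₁ → f ≢ h₂ → IsStar G w h₁ h₂ f
  star-focus₃ s i f≢h₁ f≢h₂ with IsStar.only s _ i
  ... | inj₁ f≡h₁ = ⊥-elim (f≢h₁ f≡h₁)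
  ... | inj₂ (inj₁ f≡h₂) = ⊥-elim (f≢h₂ f≡h₂)
  ... | inj₂ (inj₂ refl) = s

  star-of : ∀ {w h₁ h₂ h₃ q₁ q₂ q₃} → IsStar G w h₁ h₂ h₃ →
            q₁ ≢ q₂ → q₁ ≢ q₃ → q₂ ≢ q₃ → Incident G q₁ w → Incident G q₂ w → Incident G q₃ w →
            IsStar G w q₁ q₂ q₃
  star-of s q₁≢q₂ q₁≢q₃ q₂≢q₃ i₁ i₂ i₃ =
    let _ , _ , s₁ = star-focus s (IsStar.only s _ i₁)
        _ , s₂ = star-focus₂ s₁ i₂ (λ p → q₁≢q₂ (sym p))
    in star-focus₃ s₂ i₃ (λ p → q₁≢q₃ (sym p)) (λ p → q₂≢q₃ (sym p))

module Matchings {G : Graph} where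

  excluded : ∀ {M : E G → Bool} {f h} → M h ≡ false → T (M f) → f ≢ h
  excluded Mh Mf refl = subst T Mh Mf

  matching-at-star : ∀ {M w h₁ h₂ h₃} → IsPerfectMatching G M → IsStar G w h₁ h₂ h₃ →
                     ExactlyOne (M h₁) (M h₂) (M h₃)
  matching-at-star {M} {w} {h₁} {h₂} {h₃} pm s with pm w
  ... | e , e∈M , e-at , unique = classify (M h₁) (M h₂) (M h₃) refl refl refl
    where
    open IsStar s
    same : ∀ {f g} → M f ≡ true → M g ≡ true → Incident G f w → Incident G g w → f ≡ g
    same {f} {g} Mf Mg i j = trans (unique f (subst T (sym Mf) tt) i) (sym (unique g (subst T (sym Mg) tt) j))
    classify : ∀ b₁ b₂ b₃ → M h₁ ≡ b₁ → M h₂ ≡ b₂ → M h₃ ≡ b₃ → ExactlyOne b₁ b₂ b₃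
    classify true  true  _     p q _ = ⊥-elim (h₁≢h₂ (same p q at₁ at₂))
    classify true  false true  p _ r = ⊥-elim (h₁≢h₃ (same p r at₁ at₃))
    classify false true  true  _ q r = ⊥-elim (h₂≢h₃ (same q r at₂ at₃))
    classify true  false false _ _ _ = first
    classify false true  false _ _ _ = second
    classify false false true  _ _ _ = third
    classify false false false p q r with only e e-at
    ... | inj₁ e≡h₁ = ⊥-elim (excluded p e∈M e≡h₁)
    ... | inj₂ (inj₁ e≡h₂) = ⊥-elim (excluded q e∈M e≡h₂)
    ... | inj₂ (inj₂ e≡h₃) = ⊥-elim (excluded r e∈M e≡h₃)

  matching-from-stars : (M : E G → Bool) →
    (∀ w → Σ (E G) λ h₁ → Σ (E G) λ h₂ → Σ (E G) λ h₃ → IsStar G w h₁ h₂ h₃ × ExactlyOne (M h₁) (M h₂) (M h₃)) →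
    IsPerfectMatching G M
  matching-from-stars M stars w with stars w
  ... | h₁ , h₂ , h₃ , s , exactly = pick (M h₁) (M h₂) (M h₃) refl refl refl exactly
    where
    open IsStar s
    Chosen : Set
    Chosen = Σ (E G) λ e → T (M e) × Incident G e w × (∀ f → T (M f) → Incident G f w → f ≡ e)
    chosen : ∀ {h} → M h ≡ true → Incident G h w → (∀ f → T (M f) → In3 f h₁ h₂ h₃ → f ≡ h) → Chosen
    chosen {h} Mh i unique = h , subst T (sym Mh) tt , i , λ f Mf j → unique f Mf (only f j)
    pick : ∀ b₁ b₂ b₃ → M h₁ ≡ b₁ → M h₂ ≡ b₂ → M h₃ ≡ b₃ → ExactlyOne b₁ b₂ b₃ → Chosen
    pick _ _ _ p q r first = chosen p at₁ λ
      { f Mf (inj₁ f≡h₁) → f≡h₁ ; f Mf (inj₂ (inj₁ f≡h₂)) → ⊥-elim (excluded q Mf f≡h₂)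
      ; f Mf (inj₂ (inj₂ f≡h₃)) → ⊥-elim (excluded r Mf f≡h₃) }
    pick _ _ _ p q r second = chosen q at₂ λ
      { f Mf (inj₁ f≡h₁) → ⊥-elim (excluded p Mf f≡h₁) ; f Mf (inj₂ (inj₁ f≡h₂)) → f≡h₂
      ; f Mf (inj₂ (inj₂ f≡h₃)) → ⊥-elim (excluded r Mf f≡h₃) }
    pick _ _ _ p q r third = chosen r at₃ λ
      { f Mf (inj₁ f≡h₁) → ⊥-elim (excluded p Mf f≡h₁) ; f Mf (inj₂ (inj₁ f≡h₂)) → ⊥-elim (excluded q Mf f≡h₂)
      ; f Mf (inj₂ (inj₂ f≡h₃)) → f≡h₃ }

module Counting {G : Graph} where
  open Matchings {G}

  count-∷ : ∀ e M Ms → count G e (M ∷ Ms) ≡ ind (proj₁ M e) ℕ.+ count G e Ms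
  count-∷ e (M , _) Ms with M e
  ... | true = refl
  ... | false = refl

  count-sum : ∀ e Ms → count G e Ms ≡ Σℕ⟨ Ms ⟩ (λ M → ind (proj₁ M e))
  count-sum e [] = refl
  count-sum e (M ∷ Ms) = trans (count-∷ e M Ms) (cong (ind (proj₁ M e) ℕ.+_) (count-sum e Ms))

  count₃ : ∀ h₁ h₂ h₃ Ms → count G h₁ Ms ℕ.+ count G h₂ Ms ℕ.+ count G h₃ Ms ≡
           Σℕ⟨ Ms ⟩ (λ M → ind (proj₁ M h₁) ℕ.+ ind (proj₁ M h₂) ℕ.+ ind (proj₁ M h₃))
  count₃ h₁ h₂ h₃ Ms = trans
    (cong₂ ℕ._+_ (cong₂ ℕ._+_ (count-sum h₁ Ms) (count-sum h₂ Ms)) (count-sum h₃ Ms))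
    (sym (Σℕ-+₃ Ms (λ M → ind (proj₁ M h₁)) (λ M → ind (proj₁ M h₂)) (λ M → ind (proj₁ M h₃))))

  count-star : ∀ {w h₁ h₂ h₃} → IsStar G w h₁ h₂ h₃ → ∀ Ms →
               count G h₁ Ms ℕ.+ count G h₂ Ms ℕ.+ count G h₃ Ms ≡ length Ms
  count-star {h₁ = h₁} {h₂} {h₃} s Ms = begin
    count G h₁ Ms ℕ.+ count G h₂ Ms ℕ.+ count G h₃ Ms
      ≡⟨ count₃ h₁ h₂ h₃ Ms ⟩
    Σℕ⟨ Ms ⟩ (λ M → ind (proj₁ M h₁) ℕ.+ ind (proj₁ M h₂) ℕ.+ ind (proj₁ M h₃))
      ≡⟨ Σℕ-cong Ms (λ (M , pm) → exactlyOne-sum (matching-at-star pm s)) ⟩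
    Σℕ⟨ Ms ⟩ (λ _ → 1)
      ≡⟨ Σℕ-ones Ms ⟩
    length Ms ∎
    where open ≡-Reasoning

  covered⇒count : ∀ e Ms → Any (λ M → T (proj₁ M e)) Ms → 1 ≤ count G e Ms
  covered⇒count e ((M , _) ∷ Ms) (here e∈M) with M e
  ... | true  = s≤s z≤n
  ... | false = ⊥-elim e∈M
  covered⇒count e ((M , _) ∷ Ms) (there c) with M e
  ... | true  = s≤s z≤n
  ... | false = covered⇒count e Ms c

  count⇒covered : ∀ e Ms → 1 ≤ count G e Ms → Any (λ M → T (proj₁ M e)) Ms
  count⇒covered e ((M , _) ∷ Ms) pos with M e in e∈M
  ... | true  = here (subst T (sym e∈M) tt)
  ... | false = there (count⇒covered e Ms pos)

  odd⇒positive : ∀ n → n ℕ.% 2 ≡ 1 → 1 ≤ n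
  odd⇒positive (suc n) _ = s≤s z≤n

  odd-covering⇒covering : ∀ Ms → IsOddCovering G Ms → IsCovering G Ms
  odd-covering⇒covering Ms odd e = count⇒covered e Ms (odd⇒positive _ (odd e))

  odd-five : TauAtLeast5 G → ∀ Ns → IsOddCovering G Ns → length Ns ≡ 5 → TauOddIs5 G
  odd-five τ≥5 Ns odd five = (Ns , odd , five) , λ Ls odd′ → τ≥5 Ls (odd-covering⇒covering Ls odd′)

  star-bound : ∀ {w h₁ h₂ h₃} → IsStar G w h₁ h₂ h₃ → ∀ Ms →
               1 ≤ count G h₂ Ms → 1 ≤ count G h₃ Ms → count G h₁ Ms ℕ.+ 2 ≤ length Ms
  star-bound {h₁ = h₁} {h₂} {h₃} s Ms pos₂ pos₃ = begin
    count G h₁ Ms ℕ.+ 2                                    ≤⟨ ℕₚ.+-monoʳ-≤ (count G h₁ Ms) (ℕₚ.+-mono-≤ pos₂ pos₃) ⟩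
    count G h₁ Ms ℕ.+ (count G h₂ Ms ℕ.+ count G h₃ Ms)    ≡⟨ sym (ℕₚ.+-assoc (count G h₁ Ms) _ _) ⟩
    count G h₁ Ms ℕ.+ count G h₂ Ms ℕ.+ count G h₃ Ms      ≡⟨ count-star s Ms ⟩
    length Ms                                              ∎
    where open ℕₚ.≤-Reasoning

module Degrees {H : Graph} (F : Finite H) where

  vertexList : List (V H)
  vertexList = deduplicate (decV F) (vertices F)

  edgeList : List (E H)
  edgeList = deduplicate (decE F) (edges F)

  vertexList-unique : Unique vertexList
  vertexList-unique = UniqueDec.deduplicate-! (decV F) (vertices F)

  edgeList-unique : Unique edgeList
  edgeList-unique = UniqueDec.deduplicate-! (decE F) (edges F)

  ends : E H → V H → Parity
  ends e v = holds (decV F (end₁ H e) v) ℙ.+ holds (decV F (end₂ H e) v)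

  deg : (E H → Parity) → V H → Parity
  deg W v = Σℙ⟨ edgeList ⟩ (λ e → W e ℙ.* ends e v)

  all-ends : ∀ e → Σℙ⟨ vertexList ⟩ (ends e) ≡ 0ℙ
  all-ends e = begin
    Σℙ⟨ vertexList ⟩ (ends e)
      ≡⟨ Σℙ-+ vertexList (λ v → holds (decV F (end₁ H e) v)) (λ v → holds (decV F (end₂ H e) v)) ⟩
    Σℙ⟨ vertexList ⟩ (λ v → holds (decV F (end₁ H e) v)) ℙ.+ Σℙ⟨ vertexList ⟩ (λ v → holds (decV F (end₂ H e) v))
      ≡⟨ cong₂ ℙ._+_ (end-once (end₁ H e)) (end-once (end₂ H e)) ⟩
    1ℙ ℙ.+ 1ℙ ∎
    where
    open ≡-Reasoning
    end-once : ∀ u → Σℙ⟨ vertexList ⟩ (λ v → holds (decV F u v)) ≡ 1ℙ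
    end-once u = Σℙ-point (decV F) vertexList-unique (∈-deduplicate⁺ (decV F) (allV F u)) (λ _ → 1ℙ)

  -- the handshake lemma: the degrees sum to twice the total weight
  handshake : ∀ W → Σℙ⟨ vertexList ⟩ (deg W) ≡ 0ℙ
  handshake W = begin
    Σℙ⟨ vertexList ⟩ (λ v → Σℙ⟨ edgeList ⟩ (λ e → W e ℙ.* ends e v))
      ≡⟨ Σℙ-swap vertexList edgeList (λ v e → W e ℙ.* ends e v) ⟩
    Σℙ⟨ edgeList ⟩ (λ e → Σℙ⟨ vertexList ⟩ (λ v → W e ℙ.* ends e v))
      ≡⟨ Σℙ-cong edgeList (λ e → Σℙ-*ˡ vertexList (W e) (ends e)) ⟩
    Σℙ⟨ edgeList ⟩ (λ e → W e ℙ.* Σℙ⟨ vertexList ⟩ (ends e))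
      ≡⟨ Σℙ-zero edgeList (λ e _ → trans (cong (W e ℙ.*_) (all-ends e)) (ℙₚ.*-zeroʳ (W e))) ⟩
    0ℙ ∎
    where open ≡-Reasoning

  ends-at : Loopless H → ∀ {e v} → Incident H e v → ends e v ≡ 1ℙ
  ends-at loopless {e} {v} i with decV F (end₁ H e) v | decV F (end₂ H e) v | i
  ... | yes p | yes q | _      = ⊥-elim (loopless e (trans p (sym q)))
  ... | yes _ | no _  | _      = refl
  ... | no _  | yes _ | _      = refl
  ... | no p  | no _  | inj₁ r = ⊥-elim (p r)
  ... | no _  | no q  | inj₂ r = ⊥-elim (q r)

  ends-off : ∀ {e v} → ¬ Incident H e v → ends e v ≡ 0ℙ
  ends-off {e} {v} ¬i with decV F (end₁ H e) v | decV F (end₂ H e) v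
  ... | yes p | _     = ⊥-elim (¬i (inj₁ p))
  ... | no _  | yes q = ⊥-elim (¬i (inj₂ q))
  ... | no _  | no _  = refl

  ends-star : Loopless H → ∀ {v h₁ h₂ h₃} → IsStar H v h₁ h₂ h₃ → ∀ e →
              ends e v ≡ holds (decE F h₁ e) ℙ.+ holds (decE F h₂ e) ℙ.+ holds (decE F h₃ e)
  ends-star loopless {v} {h₁} {h₂} {h₃} s e with decE F h₁ e | decE F h₂ e | decE F h₃ e
  ... | yes refl | yes q    | _        = ⊥-elim (IsStar.h₁≢h₂ s (sym q))
  ... | yes refl | no _     | yes r    = ⊥-elim (IsStar.h₁≢h₃ s (sym r))
  ... | no _     | yes refl | yes r    = ⊥-elim (IsStar.h₂≢h₃ s (sym r))
  ... | yes refl | no _     | no _     = ends-at loopless (IsStar.at₁ s)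
  ... | no _     | yes refl | no _     = ends-at loopless (IsStar.at₂ s)
  ... | no _     | no _     | yes refl = ends-at loopless (IsStar.at₃ s)
  ... | no p     | no q     | no r     = ends-off λ i → away (IsStar.only s e i)
    where
    away : ¬ In3 e h₁ h₂ h₃
    away (inj₁ e≡h₁) = p (sym e≡h₁)
    away (inj₂ (inj₁ e≡h₂)) = q (sym e≡h₂)
    away (inj₂ (inj₂ e≡h₃)) = r (sym e≡h₃)

  deg-star : Loopless H → ∀ W {v h₁ h₂ h₃} → IsStar H v h₁ h₂ h₃ → deg W v ≡ W h₁ ℙ.+ W h₂ ℙ.+ W h₃
  deg-star loopless W {v} {h₁} {h₂} {h₃} s = begin
    Σℙ⟨ edgeList ⟩ (λ e → W e ℙ.* ends e v)
      ≡⟨ Σℙ-cong edgeList (λ e → trans (cong (W e ℙ.*_) (ends-star loopless s e)) (distrib₃ (W e) _ _ _)) ⟩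
    Σℙ⟨ edgeList ⟩ (λ e → (W e ℙ.* at h₁ e) ℙ.+ (W e ℙ.* at h₂ e) ℙ.+ (W e ℙ.* at h₃ e))
      ≡⟨ Σℙ-+₃ edgeList (λ e → W e ℙ.* at h₁ e) (λ e → W e ℙ.* at h₂ e) (λ e → W e ℙ.* at h₃ e) ⟩
    Σℙ⟨ edgeList ⟩ (λ e → W e ℙ.* at h₁ e) ℙ.+ Σℙ⟨ edgeList ⟩ (λ e → W e ℙ.* at h₂ e)
      ℙ.+ Σℙ⟨ edgeList ⟩ (λ e → W e ℙ.* at h₃ e)
      ≡⟨ cong₂ ℙ._+_ (cong₂ ℙ._+_ (pick h₁) (pick h₂)) (pick h₃) ⟩
    W h₁ ℙ.+ W h₂ ℙ.+ W h₃ ∎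
    where
    open ≡-Reasoning
    at : E H → E H → Parity
    at h e = holds (decE F h e)
    pick : ∀ h → Σℙ⟨ edgeList ⟩ (λ e → W e ℙ.* at h e) ≡ W h
    pick h = Σℙ-point (decE F) edgeList-unique (∈-deduplicate⁺ (decE F) (allE F h)) W
    distrib₃ : ∀ p a b c → p ℙ.* (a ℙ.+ b ℙ.+ c) ≡ (p ℙ.* a) ℙ.+ (p ℙ.* b) ℙ.+ (p ℙ.* c)
    distrib₃ 0ℙ a b c = refl
    distrib₃ 1ℙ a b c = refl

  -- Parity lemma for cubic graphs: if the three edges around every vertex other than x carry odd
  -- total weight, so do the three edges around x.  (Shift all weights by 1: the shifted degrees
  -- vanish off x since 3 is odd, and they sum to 0 by the handshake lemma.)
  odd-around : Cubic H → ∀ x (W : E H → Parity) →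
    (∀ {v h₁ h₂ h₃} → v ≢ x → IsStar H v h₁ h₂ h₃ → W h₁ ℙ.+ W h₂ ℙ.+ W h₃ ≡ 1ℙ) →
    ∀ {h₁ h₂ h₃} → IsStar H x h₁ h₂ h₃ → W h₁ ℙ.+ W h₂ ℙ.+ W h₃ ≡ 1ℙ
  odd-around cubic x W odd {h₁} {h₂} {h₃} s = ℙₚ.⁻¹-injective (begin
    (W h₁ ℙ.+ W h₂ ℙ.+ W h₃) ⁻¹       ≡⟨ sym (flip₃ (W h₁) (W h₂) (W h₃)) ⟩
    Wᶜ h₁ ℙ.+ Wᶜ h₂ ℙ.+ Wᶜ h₃         ≡⟨ sym (deg-star (proj₁ cubic) Wᶜ s) ⟩
    deg Wᶜ x                          ≡⟨ sym (Σℙ-single vertexList-unique x∈vertexList even-off-x) ⟩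
    Σℙ⟨ vertexList ⟩ (deg Wᶜ)         ≡⟨ handshake Wᶜ ⟩
    0ℙ                                ∎)
    where
    open ≡-Reasoning
    Wᶜ : E H → Parity
    Wᶜ e = W e ⁻¹
    flip₃ : ∀ a b c → a ⁻¹ ℙ.+ b ⁻¹ ℙ.+ c ⁻¹ ≡ (a ℙ.+ b ℙ.+ c) ⁻¹
    flip₃ 0ℙ 0ℙ c = refl
    flip₃ 0ℙ 1ℙ c = refl
    flip₃ 1ℙ 0ℙ c = refl
    flip₃ 1ℙ 1ℙ c = refl
    x∈vertexList : x ∈ vertexList
    x∈vertexList = ∈-deduplicate⁺ (decV F) (allV F x)
    even-off-x : ∀ v → v ≢ x → deg Wᶜ v ≡ 0ℙ
    even-off-x v v≢x with cubic-star cubic v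
    ... | g₁ , g₂ , g₃ , t = begin
      deg Wᶜ v                          ≡⟨ deg-star (proj₁ cubic) Wᶜ t ⟩
      Wᶜ g₁ ℙ.+ Wᶜ g₂ ℙ.+ Wᶜ g₃         ≡⟨ flip₃ (W g₁) (W g₂) (W g₃) ⟩
      (W g₁ ℙ.+ W g₂ ℙ.+ W g₃) ⁻¹       ≡⟨ cong _⁻¹ (odd v≢x t) ⟩
      0ℙ                                ∎

-- Γ contains a copy of H − x: every edge of H has an image in Γ, the edges ea, eb, ec at x
-- become ca, cb, cc, and the star of every vertex v ≠ x becomes a star of Γ.
record Embedding (H Γ : Graph) (x : V H) (ea eb ec : E H) (ca cb cc : E Γ) : Set where
  field
    lift      : E H → E Γ
    lift-a    : lift ea ≡ ca
    lift-b    : lift eb ≡ cb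
    lift-c    : lift ec ≡ cc
    lift-star : ∀ {v h₁ h₂ h₃} → v ≢ x → IsStar H v h₁ h₂ h₃ →
                Σ (V Γ) λ u → IsStar Γ u (lift h₁) (lift h₂) (lift h₃)

  to-cut : (P : E Γ → E Γ → E Γ → Set) → P (lift ea) (lift eb) (lift ec) → P ca cb cc
  to-cut P p rewrite sym lift-a | sym lift-b | sym lift-c = p

  from-cut : (P : E Γ → E Γ → E Γ → Set) → P ca cb cc → P (lift ea) (lift eb) (lift ec)
  from-cut P p rewrite lift-a | lift-b | lift-c = p

module Side {H Γ : Graph} (F : Finite H) (cubic : Cubic H) {x : V H} {ea eb ec : E H} {ca cb cc : E Γ}
            (starX : IsStar H x ea eb ec) (emb : Embedding H Γ x ea eb ec ca cb cc) where
  open Embedding emb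
  open Degrees F using (odd-around)

  cut-parity : (M : PerfectMatching Γ) → OddOfThree (proj₁ M ca) (proj₁ M cb) (proj₁ M cc)
  cut-parity (M , pm) = odd-view (M ca) (M cb) (M cc)
    (to-cut (λ p q r → W′ p ℙ.+ W′ q ℙ.+ W′ r ≡ 1ℙ) (odd-around cubic x (W′ ∘ lift) off-x starX))
    where
    W′ : E Γ → Parity
    W′ f = parity (ind (M f))
    off-x : ∀ {v h₁ h₂ h₃} → v ≢ x → IsStar H v h₁ h₂ h₃ → W′ (lift h₁) ℙ.+ W′ (lift h₂) ℙ.+ W′ (lift h₃) ≡ 1ℙ
    off-x v≢x s = exactlyOne-odd (Matchings.matching-at-star pm (proj₂ (lift-star v≢x s)))

  -- M uses the whole cut
  full : PerfectMatching Γ → Bool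
  full (M , _) = M ca ∧ M cb

  #full : List (PerfectMatching Γ) → ℕ
  #full Ms = Σℕ⟨ Ms ⟩ (λ M → ind (full M))

  restrict : (M : PerfectMatching Γ) → full M ≡ false → PerfectMatching H
  restrict (M , pm) not-full = (M ∘ lift) , Matchings.matching-from-stars (M ∘ lift) star-at
    where
    star-at : ∀ w → Σ (E H) λ h₁ → Σ (E H) λ h₂ → Σ (E H) λ h₃ →
              IsStar H w h₁ h₂ h₃ × ExactlyOne (M (lift h₁)) (M (lift h₂)) (M (lift h₃))
    star-at w with decV F w x
    ... | yes refl = ea , eb , ec , starX ,
          from-cut (λ p q r → ExactlyOne (M p) (M q) (M r)) (odd-not-all (cut-parity (M , pm)) not-full)
    ... | no w≢x with cubic-star cubic w
    ...   | h₁ , h₂ , h₃ , s = h₁ , h₂ , h₃ , s , Matchings.matching-at-star pm (proj₂ (lift-star w≢x s))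

  restrict-all : ∀ Ms → #full Ms ≡ 0 → Σ (List (PerfectMatching H)) λ Ns →
                 length Ns ≡ length Ms × (∀ e → count H e Ns ≡ count Γ (lift e) Ms)
  restrict-all [] _ = [] , refl , λ _ → refl
  restrict-all (M ∷ Ms) none with restrict-all Ms (ℕₚ.m+n≡0⇒n≡0 (ind (full M)) none)
  ... | Ns , same-length , same-count = N ∷ Ns , cong suc same-length , λ e → begin
    count H e (N ∷ Ns)                          ≡⟨ Counting.count-∷ e N Ns ⟩
    ind (proj₁ M (lift e)) ℕ.+ count H e Ns     ≡⟨ cong (ind (proj₁ M (lift e)) ℕ.+_) (same-count e) ⟩
    ind (proj₁ M (lift e)) ℕ.+ count Γ (lift e) Ms ≡⟨ sym (Counting.count-∷ (lift e) M Ms) ⟩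
    count Γ (lift e) (M ∷ Ms)                   ∎
    where
    open ≡-Reasoning
    N : PerfectMatching H
    N = restrict M (ind≡0 (ℕₚ.m+n≡0⇒m≡0 (ind (full M)) none))

  covering-restricts : ∀ Ms → IsCovering Γ Ms → #full Ms ≡ 0 →
                       Σ (List (PerfectMatching H)) λ Ns → IsCovering H Ns × length Ns ≡ length Ms
  covering-restricts Ms cover none with restrict-all Ms none
  ... | Ns , same-length , same-count = Ns , covers , same-length
    where
    covers : IsCovering H Ns
    covers e = Counting.count⇒covered e Ns
      (subst (1 ≤_) (sym (same-count e)) (Counting.covered⇒count (lift e) Ms (cover (lift e))))

  odd-covering-restricts : ∀ Ms → IsOddCovering Γ Ms → #full Ms ≡ 0 →
                           Σ (List (PerfectMatching H)) λ Ns → IsOddCovering H Ns × length Ns ≡ length Ms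
  odd-covering-restricts Ms odd none with restrict-all Ms none
  ... | Ns , same-length , same-count =
    Ns , (λ e → subst (λ k → k ℕ.% 2 ≡ 1) (sym (same-count e)) (odd (lift e))) , same-length

  cut-bound : ∀ Ms → (∀ e → 1 ≤ count Γ (lift e) Ms) → ∀ {c} → c ≢ x → Incident H ec c →
              count Γ cc Ms ℕ.+ 2 ≤ length Ms
  cut-bound Ms pos {c} c≢x ec-at with cubic-star cubic c
  ... | h₁ , h₂ , h₃ , s with star-focus s (IsStar.only s ec ec-at)
  ...   | g₂ , g₃ , t = subst (λ f → count Γ f Ms ℕ.+ 2 ≤ length Ms) lift-c
          (Counting.star-bound (proj₂ (lift-star c≢x t)) Ms (pos g₂) (pos g₃))

  -- in an odd covering of Γ by five matchings, evenly many matchings use the whole cut: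
  -- halving the (odd) edge counts gives a weighting to which the parity lemma applies
  full-even : ∀ Ms → IsOddCovering Γ Ms → length Ms ≡ 5 → parity (#full Ms) ≡ 0ℙ
  full-even Ms odd five = begin
    parity n                                      ≡⟨ sym (ℙₚ.suc-homo-⁻¹ n) ⟩
    parity (suc n) ⁻¹                             ≡⟨ cong (λ m → parity m ⁻¹) (sym halves-at-cut) ⟩
    parity (half ca ℕ.+ half cb ℕ.+ half cc) ⁻¹   ≡⟨ cong _⁻¹ (parity₃ (half ca) (half cb) (half cc)) ⟩
    (W′ ca ℙ.+ W′ cb ℙ.+ W′ cc) ⁻¹                 ≡⟨ cong _⁻¹ (to-cut (λ p q r → W′ p ℙ.+ W′ q ℙ.+ W′ r ≡ 1ℙ)
                                                        (odd-around cubic x (W′ ∘ lift) off-x starX)) ⟩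
    0ℙ                                            ∎
    where
    open ≡-Reasoning
    n : ℕ
    n = #full Ms
    k : E Γ → ℕ
    k f = count Γ f Ms
    k-odd : ∀ f → parity (k f) ≡ 1ℙ
    k-odd f = odd-mod (k f) (odd f)
    half : E Γ → ℕ
    half f = ⌊ k f /2⌋
    W′ : E Γ → Parity
    W′ f = parity (half f)
    -- around a vertex v ≠ x the counts are odd and add up to 5, so their halves add up to 1
    off-x : ∀ {v h₁ h₂ h₃} → v ≢ x → IsStar H v h₁ h₂ h₃ → W′ (lift h₁) ℙ.+ W′ (lift h₂) ℙ.+ W′ (lift h₃) ≡ 1ℙ
    off-x {h₁ = h₁} {h₂} {h₃} v≢x s =
      trans (sym (parity₃ (half (lift h₁)) (half (lift h₂)) (half (lift h₃))))
            (cong parity (odd-triple (k (lift h₁)) (k (lift h₂)) (k (lift h₃)) 0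
                                     (k-odd (lift h₁)) (k-odd (lift h₂)) (k-odd (lift h₃))
                                     (trans (Counting.count-star (proj₂ (lift-star v≢x s)) Ms) five)))
    -- a matching meets the cut once, or three times if it uses the whole cut
    cut-sum : k ca ℕ.+ k cb ℕ.+ k cc ≡ 5 ℕ.+ 2 ℕ.* n
    cut-sum = begin
      k ca ℕ.+ k cb ℕ.+ k cc                         ≡⟨ Counting.count₃ ca cb cc Ms ⟩
      Σℕ⟨ Ms ⟩ (λ M → ind (proj₁ M ca) ℕ.+ ind (proj₁ M cb) ℕ.+ ind (proj₁ M cc))
        ≡⟨ Σℕ-cong Ms (λ M → odd-weight (cut-parity M)) ⟩
      Σℕ⟨ Ms ⟩ (λ M → 1 ℕ.+ 2 ℕ.* ind (full M))      ≡⟨ Σℕ-+ Ms (λ _ → 1) _ ⟩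
      Σℕ⟨ Ms ⟩ (λ _ → 1) ℕ.+ Σℕ⟨ Ms ⟩ (λ M → 2 ℕ.* ind (full M))
        ≡⟨ cong₂ ℕ._+_ (trans (Σℕ-ones Ms) five) (Σℕ-*ˡ Ms 2 (λ M → ind (full M))) ⟩
      5 ℕ.+ 2 ℕ.* n                                  ∎
    halves-at-cut : half ca ℕ.+ half cb ℕ.+ half cc ≡ suc n
    halves-at-cut = odd-triple (k ca) (k cb) (k cc) n (k-odd ca) (k-odd cb) (k-odd cc) cut-sum

Joins : (G : Graph) → E G → V G → V G → Set
Joins G e w z = (end₁ G e ≡ w × end₂ G e ≡ z) ⊎ (end₁ G e ≡ z × end₂ G e ≡ w)

module Joining {G : Graph} (loopless : Loopless G) where

  joins-at₁ : ∀ {e w z} → Joins G e w z → Incident G e w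
  joins-at₁ (inj₁ (p , _)) = inj₁ p
  joins-at₁ (inj₂ (_ , q)) = inj₂ q

  joins-at₂ : ∀ {e w z} → Joins G e w z → Incident G e z
  joins-at₂ (inj₁ (_ , q)) = inj₂ q
  joins-at₂ (inj₂ (p , _)) = inj₁ p

  joins-distinct-ends : ∀ {e w z} → Joins G e w z → z ≢ w
  joins-distinct-ends {e} (inj₁ (p , q)) z≡w = loopless e (trans p (trans (sym z≡w) (sym q)))
  joins-distinct-ends {e} (inj₂ (p , q)) z≡w = loopless e (trans p (trans z≡w (sym q)))

  joins-other : ∀ {e w z v} → Joins G e w z → Incident G e v → v ≢ w → v ≡ z
  joins-other (inj₁ (p , _)) (inj₁ r) v≢w = ⊥-elim (v≢w (trans (sym r) p))
  joins-other (inj₁ (_ , q)) (inj₂ r) _   = trans (sym r) q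
  joins-other (inj₂ (p , _)) (inj₁ r) _   = trans (sym r) p
  joins-other (inj₂ (_ , q)) (inj₂ r) v≢w = ⊥-elim (v≢w (trans (sym r) q))

  joins-distinct : ∀ {e f w a b} → Joins G e w a → Joins G f w b → a ≢ b → e ≢ f
  joins-distinct p q a≢b refl = a≢b (joins-other q (joins-at₂ p) (joins-distinct-ends p))

module Neighbourhood {G : Graph} (cubic : Cubic G) {x a b c : V G} (nb : NeighboursAre G x a b c) where
  open Joining (proj₁ cubic)

  ea eb ec : E G
  ea = proj₁ (proj₁ nb)
  eb = proj₁ (proj₁ (proj₂ nb))
  ec = proj₁ (proj₁ (proj₂ (proj₂ nb)))

  joins-a : Joins G ea x a
  joins-a = proj₂ (proj₁ nb)
  joins-b : Joins G eb x b
  joins-b = proj₂ (proj₁ (proj₂ nb))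
  joins-c : Joins G ec x c
  joins-c = proj₂ (proj₁ (proj₂ (proj₂ nb)))

  a≢b : a ≢ b
  a≢b = proj₁ (proj₂ (proj₂ (proj₂ nb)))
  a≢c : a ≢ c
  a≢c = proj₁ (proj₂ (proj₂ (proj₂ (proj₂ nb))))
  b≢c : b ≢ c
  b≢c = proj₂ (proj₂ (proj₂ (proj₂ (proj₂ nb))))

  a≢x : a ≢ x
  a≢x = joins-distinct-ends joins-a
  b≢x : b ≢ x
  b≢x = joins-distinct-ends joins-b
  c≢x : c ≢ x
  c≢x = joins-distinct-ends joins-c

  ec-at-c : Incident G ec c
  ec-at-c = joins-at₂ joins-c

  starX : IsStar G x ea eb ec
  starX = star-of (proj₂ (proj₂ (proj₂ (cubic-star cubic x))))
    (joins-distinct joins-a joins-b a≢b) (joins-distinct joins-a joins-c a≢c) (joins-distinct joins-b joins-c b≢c)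
    (joins-at₁ joins-a) (joins-at₁ joins-b) (joins-at₁ joins-c)

InnerEdge : (H : Graph) → DecidableEquality (V H) → V H → Set
InnerEdge H dec x = Σ (E H) λ e → False (dec (end₁ H e) x) × False (dec (end₂ H e) x)

-- the ways an edge f of Γ can sit at the image of a vertex v of H: as the copy of an edge at v
-- avoiding x, or as the cut edge replacing the edge from x to v
Origin : (H Γ : Graph) (F : Finite H) (x a b c : V H) → (InnerEdge H (decV F) x → E Γ) →
         E Γ → E Γ → E Γ → V H → E Γ → Set
Origin H Γ F x a b c inner ca cb cc v f =
  (Σ (InnerEdge H (decV F) x) λ i → inner i ≡ f × Incident H (proj₁ i) v)
  ⊎ (f ≡ ca × v ≡ a) ⊎ (f ≡ cb × v ≡ b) ⊎ (f ≡ cc × v ≡ c)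

-- How H − x is attached inside Γ: vertices are placed, edges avoiding x are copied, and the
-- edges from x to a, b, c are replaced by cut edges ca, cb, cc leaving place a, place b, place c.
record Attachment (H Γ : Graph) (F : Finite H) (x a b c : V H) (ea eb ec : E H) : Set where
  field
    place        : V H → V Γ
    inner        : InnerEdge H (decV F) x → E Γ
    ca cb cc     : E Γ
    unlift       : E Γ → E H
    unlift-inner : ∀ i → unlift (inner i) ≡ proj₁ i
    unlift-a     : unlift ca ≡ ea
    unlift-b     : unlift cb ≡ eb
    unlift-c     : unlift cc ≡ ec
    inner-at     : ∀ {v} i → Incident H (proj₁ i) v → Incident Γ (inner i) (place v)
    ca-at        : Incident Γ ca (place a)
    cb-at        : Incident Γ cb (place b)
    cc-at        : Incident Γ cc (place c)
    classify     : ∀ {v} → v ≢ x → ∀ f → Incident Γ f (place v) → Origin H Γ F x a b c inner ca cb cc v f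

module Attached {H Γ : Graph} {F : Finite H} (cubic : Cubic H) {x a b c : V H}
                (nb : NeighboursAre H x a b c)
                (A : Attachment H Γ F x a b c (Neighbourhood.ea cubic nb) (Neighbourhood.eb cubic nb)
                                              (Neighbourhood.ec cubic nb)) where
  open Neighbourhood cubic nb
  open Joining (proj₁ cubic)
  open Attachment A

  cut-image : E H → E Γ
  cut-image e with decE F e ea | decE F e eb
  ... | yes _ | _     = ca
  ... | no _  | yes _ = cb
  ... | no _  | no _  = cc

  lift-by : (e : E H) → Dec (end₁ H e ≡ x) → Dec (end₂ H e ≡ x) → E Γ
  lift-by e (no p) (no q) = inner (e , fromWitnessFalse p , fromWitnessFalse q)
  lift-by e _      _      = cut-image e

  lift : E H → E Γ
  lift e = lift-by e (decV F (end₁ H e) x) (decV F (end₂ H e) x)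

  lift-inner : ∀ i → lift (proj₁ i) ≡ inner i
  lift-inner (e , p , q) = avoiding (decV F (end₁ H e) x) (decV F (end₂ H e) x)
    where
    avoiding : ∀ d₁ d₂ → lift-by e d₁ d₂ ≡ inner (e , p , q)
    avoiding (yes r) _       = ⊥-elim (toWitnessFalse p r)
    avoiding (no _)  (yes r) = ⊥-elim (toWitnessFalse q r)
    avoiding (no _)  (no _)  = cong (λ pq → inner (e , pq)) (cong₂ _,_ (T-irrelevant _ _) (T-irrelevant _ _))

  lift-at-x : ∀ {e} → Incident H e x → lift e ≡ cut-image e
  lift-at-x {e} i with decV F (end₁ H e) x | decV F (end₂ H e) x | i
  ... | yes _ | _     | _      = refl
  ... | no _  | yes _ | _      = refl
  ... | no p  | no _  | inj₁ r = ⊥-elim (p r)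
  ... | no _  | no q  | inj₂ r = ⊥-elim (q r)

  cut-image-a : cut-image ea ≡ ca
  cut-image-a with decE F ea ea
  ... | yes _    = refl
  ... | no ea≢ea = ⊥-elim (ea≢ea refl)

  cut-image-b : cut-image eb ≡ cb
  cut-image-b with decE F eb ea | decE F eb eb
  ... | yes eb≡ea | _        = ⊥-elim (joins-distinct joins-a joins-b a≢b (sym eb≡ea))
  ... | no _      | yes _    = refl
  ... | no _      | no eb≢eb = ⊥-elim (eb≢eb refl)

  cut-image-c : cut-image ec ≡ cc
  cut-image-c with decE F ec ea | decE F ec eb
  ... | yes ec≡ea | _         = ⊥-elim (joins-distinct joins-a joins-c a≢c (sym ec≡ea))
  ... | no _      | yes ec≡eb = ⊥-elim (joins-distinct joins-b joins-c b≢c (sym ec≡eb))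
  ... | no _      | no _      = refl

  lift-a : lift ea ≡ ca
  lift-a = trans (lift-at-x (joins-at₁ joins-a)) cut-image-a

  lift-b : lift eb ≡ cb
  lift-b = trans (lift-at-x (joins-at₁ joins-b)) cut-image-b

  lift-c : lift ec ≡ cc
  lift-c = trans (lift-at-x (joins-at₁ joins-c)) cut-image-c

  data Kind : E H → Set where
    avoiding : (i : InnerEdge H (decV F) x) → Kind (proj₁ i)
    is-a     : Kind ea
    is-b     : Kind eb
    is-c     : Kind ec

  kind-at-x : ∀ {e} → Incident H e x → Kind e
  kind-at-x {e} i with IsStar.only starX e i
  ... | inj₁ refl = is-a
  ... | inj₂ (inj₁ refl) = is-b
  ... | inj₂ (inj₂ refl) = is-c

  kind-by : ∀ e → Dec (end₁ H e ≡ x) → Dec (end₂ H e ≡ x) → Kind e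
  kind-by e (no p)  (no q)  = avoiding (e , fromWitnessFalse p , fromWitnessFalse q)
  kind-by e (yes r) _       = kind-at-x (inj₁ r)
  kind-by e (no _)  (yes r) = kind-at-x (inj₂ r)

  kind : ∀ e → Kind e
  kind e = kind-by e (decV F (end₁ H e) x) (decV F (end₂ H e) x)

  lift-injective : ∀ {e f} → lift e ≡ lift f → e ≡ f
  lift-injective {e} {f} eq = trans (sym (unlift-lift e)) (trans (cong unlift eq) (unlift-lift f))
    where
    unlift-lift : ∀ e → unlift (lift e) ≡ e
    unlift-lift e with kind e
    ... | avoiding i = trans (cong unlift (lift-inner i)) (unlift-inner i)
    ... | is-a = trans (cong unlift lift-a) unlift-a
    ... | is-b = trans (cong unlift lift-b) unlift-b
    ... | is-c = trans (cong unlift lift-c) unlift-c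

  lift-at : ∀ {v} → v ≢ x → ∀ e → Incident H e v → Incident Γ (lift e) (place v)
  lift-at v≢x e i with kind e
  ... | avoiding j = subst (λ f → Incident Γ f _) (sym (lift-inner j)) (inner-at j i)
  ... | is-a = subst₂ (Incident Γ) (sym lift-a) (cong place (sym (joins-other joins-a i v≢x))) ca-at
  ... | is-b = subst₂ (Incident Γ) (sym lift-b) (cong place (sym (joins-other joins-b i v≢x))) cb-at
  ... | is-c = subst₂ (Incident Γ) (sym lift-c) (cong place (sym (joins-other joins-c i v≢x))) cc-at

  lift-back : ∀ {v} → v ≢ x → ∀ f → Incident Γ f (place v) → Σ (E H) λ e → Incident H e v × lift e ≡ f
  lift-back v≢x f i with classify v≢x f i
  ... | inj₁ (j , refl , at)              = proj₁ j , at , lift-inner j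
  ... | inj₂ (inj₁ (refl , refl))         = ea , joins-at₂ joins-a , lift-a
  ... | inj₂ (inj₂ (inj₁ (refl , refl)))  = eb , joins-at₂ joins-b , lift-b
  ... | inj₂ (inj₂ (inj₂ (refl , refl)))  = ec , joins-at₂ joins-c , lift-c

  lift-star : ∀ {v h₁ h₂ h₃} → v ≢ x → IsStar H v h₁ h₂ h₃ → Σ (V Γ) λ u → IsStar Γ u (lift h₁) (lift h₂) (lift h₃)
  lift-star {v} {h₁} {h₂} {h₃} v≢x s = place v , record
    { h₁≢h₂ = λ eq → h₁≢h₂ (lift-injective eq)
    ; h₁≢h₃ = λ eq → h₁≢h₃ (lift-injective eq)
    ; h₂≢h₃ = λ eq → h₂≢h₃ (lift-injective eq)
    ; at₁ = lift-at v≢x h₁ at₁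
    ; at₂ = lift-at v≢x h₂ at₂
    ; at₃ = lift-at v≢x h₃ at₃
    ; only = λ f i → lifted-only (lift-back v≢x f i)
    }
    where
    open IsStar s
    lifted-only : ∀ {f} → (Σ (E H) λ e → Incident H e v × lift e ≡ f) → In3 f (lift h₁) (lift h₂) (lift h₃)
    lifted-only (e , e-at , refl) with only e e-at
    ... | inj₁ e≡h₁ = inj₁ (cong lift e≡h₁)
    ... | inj₂ (inj₁ e≡h₂) = inj₂ (inj₁ (cong lift e≡h₂))
    ... | inj₂ (inj₂ e≡h₃) = inj₂ (inj₂ (cong lift e≡h₃))

  embedding : Embedding H Γ x ea eb ec ca cb cc
  embedding = record { lift = lift ; lift-a = lift-a ; lift-b = lift-b ; lift-c = lift-c ; lift-star = lift-star }

-- With z = [xy ∈ M], the stars at y and x give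
-- ExactlyOne a₁ a₂ z and ExactlyOne b₁ b₂ z, and the two cuts are met oddly.  Then c₁c₂ ∈ M
-- whenever xy ∈ M or M uses a whole cut, and these three events exclude each other.
c₁c₂-carries : ∀ {a₁ b₁ a₂ b₂ c z} → ExactlyOne a₁ a₂ z → ExactlyOne b₁ b₂ z →
               OddOfThree a₁ b₁ c → OddOfThree a₂ b₂ c → ind z ℕ.+ ind (a₁ ∧ b₁) ℕ.+ ind (a₂ ∧ b₂) ≤ ind c
c₁c₂-carries third  third  (one third) _   = s≤s z≤n
c₁c₂-carries first  first  all         _   = s≤s z≤n
c₁c₂-carries first  second _           _   = z≤n
c₁c₂-carries second first  _           _   = z≤n
c₁c₂-carries second second _           all = s≤s z≤n

module Glued (G₁ G₂ : Graph) (F₁ : Finite G₁) (F₂ : Finite G₂)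
             (x₁ a₁ b₁ c₁ : V G₁) (x₂ a₂ b₂ c₂ : V G₂)
             (cubic₁ : Cubic G₁) (nb₁ : NeighboursAre G₁ x₁ a₁ b₁ c₁)
             (cubic₂ : Cubic G₂) (nb₂ : NeighboursAre G₂ x₂ a₂ b₂ c₂) where
  open Glue G₁ G₂ (decV F₁) (decV F₂) x₁ a₁ b₁ c₁ x₂ a₂ b₂ c₂
  module N₁ = Neighbourhood cubic₁ nb₁
  module N₂ = Neighbourhood cubic₂ nb₂

  new : NewEdge → Edge
  new = inj₂ ∘ inj₂

  in₁-shape : ∀ v → v ≢ x₁ → Σ V₁⁻ λ u → proj₁ u ≡ v × in₁ v ≡ inj₁ u
  in₁-shape v v≢x₁ with decV F₁ v x₁
  ... | yes v≡x₁ = ⊥-elim (v≢x₁ v≡x₁)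
  ... | no v≢x₁′ = (v , fromWitnessFalse v≢x₁′) , refl , refl

  in₂-shape : ∀ v → v ≢ x₂ → Σ V₂⁻ λ u → proj₁ u ≡ v × in₂ v ≡ inj₂ (inj₁ u)
  in₂-shape v v≢x₂ with decV F₂ v x₂
  ... | yes v≡x₂ = ⊥-elim (v≢x₂ v≡x₂)
  ... | no v≢x₂′ = (v , fromWitnessFalse v≢x₂′) , refl , refl

  in₁-inside : ∀ {v} (p : False (decV F₁ v x₁)) → in₁ v ≡ inj₁ (v , p)
  in₁-inside {v} p with in₁-shape v (toWitnessFalse p)
  ... | (_ , p′) , refl , eq = trans eq (cong (λ q → inj₁ (v , q)) (T-irrelevant p′ p))

  in₂-inside : ∀ {v} (p : False (decV F₂ v x₂)) → in₂ v ≡ inj₂ (inj₁ (v , p))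
  in₂-inside {v} p with in₂-shape v (toWitnessFalse p)
  ... | (_ , p′) , refl , eq = trans eq (cong (λ q → inj₂ (inj₁ (v , q))) (T-irrelevant p′ p))

  in₁-injective : ∀ {w v} {p : False (decV F₁ v x₁)} → in₁ w ≡ inj₁ (v , p) → w ≡ v
  in₁-injective {w} eq with decV F₁ w x₁
  in₁-injective () | yes _
  ... | no _ = cong proj₁ (inj₁-injective eq)

  in₂-injective : ∀ {w v} {p : False (decV F₂ v x₂)} → in₂ w ≡ inj₂ (inj₁ (v , p)) → w ≡ v
  in₂-injective {w} eq with decV F₂ w x₂
  in₂-injective () | yes _
  ... | no _ = cong proj₁ (inj₁-injective (inj₂-injective eq))

  in₁-not-right : ∀ {w u} → in₁ w ≢ inj₂ (inj₁ u)
  in₁-not-right {w} with decV F₁ w x₁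
  ... | yes _ = λ ()
  ... | no _  = λ ()

  in₂-not-left : ∀ {w u} → in₂ w ≢ inj₁ u
  in₂-not-left {w} with decV F₂ w x₂
  ... | yes _ = λ ()
  ... | no _  = λ ()

  in₁-not-new : ∀ {w z} → w ≢ x₁ → in₁ w ≢ inj₂ (inj₂ z)
  in₁-not-new w≢x₁ eq with trans (sym (in₁-inside (fromWitnessFalse w≢x₁))) eq
  ... | ()

  in₂-not-new : ∀ {w z} → w ≢ x₂ → in₂ w ≢ inj₂ (inj₂ z)
  in₂-not-new w≢x₂ eq with trans (sym (in₂-inside (fromWitnessFalse w≢x₂))) eq
  ... | ()

  side₁ : Attachment G₁ glued F₁ x₁ a₁ b₁ c₁ N₁.ea N₁.eb N₁.ec
  side₁ = record
    { place = in₁ ; inner = inj₁ ; ca = new a₁y ; cb = new b₁x ; cc = new c₁c₂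
    ; unlift = unlift ; unlift-inner = λ _ → refl ; unlift-a = refl ; unlift-b = refl ; unlift-c = refl
    ; inner-at = inner-at ; ca-at = inj₁ refl ; cb-at = inj₁ refl ; cc-at = inj₁ refl
    ; classify = classify }
    where
    unlift : Edge → E G₁
    unlift (inj₁ (e , _))     = e
    unlift (inj₂ (inj₂ a₁y))  = N₁.ea
    unlift (inj₂ (inj₂ b₁x))  = N₁.eb
    unlift (inj₂ (inj₂ c₁c₂)) = N₁.ec
    unlift _                  = N₁.ea
    inner-at : ∀ {v} i → Incident G₁ (proj₁ i) v → Incident glued (inj₁ i) (in₁ v)
    inner-at (e , p , q) (inj₁ refl) = inj₁ (sym (in₁-inside p))
    inner-at (e , p , q) (inj₂ refl) = inj₂ (sym (in₁-inside q))
    classify : ∀ {v} → v ≢ x₁ → ∀ f → Incident glued f (in₁ v) →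
               Origin G₁ glued F₁ x₁ a₁ b₁ c₁ inj₁ (new a₁y) (new b₁x) (new c₁c₂) v f
    classify {v} v≢x₁ f i = sorted f (subst (Incident glued f) (in₁-inside p) i)
      where
      p : False (decV F₁ v x₁)
      p = fromWitnessFalse v≢x₁
      sorted : ∀ f → Incident glued f (inj₁ (v , p)) →
               Origin G₁ glued F₁ x₁ a₁ b₁ c₁ inj₁ (new a₁y) (new b₁x) (new c₁c₂) v f
      sorted (inj₁ j)           (inj₁ r) = inj₁ (j , refl , inj₁ (cong proj₁ (inj₁-injective r)))
      sorted (inj₁ j)           (inj₂ r) = inj₁ (j , refl , inj₂ (cong proj₁ (inj₁-injective r)))
      sorted (inj₂ (inj₁ _))    (inj₁ ())
      sorted (inj₂ (inj₁ _))    (inj₂ ())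
      sorted (inj₂ (inj₂ a₁y))  (inj₁ r) = inj₂ (inj₁ (refl , sym (in₁-injective r)))
      sorted (inj₂ (inj₂ a₁y))  (inj₂ ())
      sorted (inj₂ (inj₂ b₁x))  (inj₁ r) = inj₂ (inj₂ (inj₁ (refl , sym (in₁-injective r))))
      sorted (inj₂ (inj₂ b₁x))  (inj₂ ())
      sorted (inj₂ (inj₂ c₁c₂)) (inj₁ r) = inj₂ (inj₂ (inj₂ (refl , sym (in₁-injective r))))
      sorted (inj₂ (inj₂ c₁c₂)) (inj₂ r) = ⊥-elim (in₂-not-left r)
      sorted (inj₂ (inj₂ a₂y))  (inj₁ r) = ⊥-elim (in₂-not-left r)
      sorted (inj₂ (inj₂ a₂y))  (inj₂ ())
      sorted (inj₂ (inj₂ b₂x))  (inj₁ r) = ⊥-elim (in₂-not-left r)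
      sorted (inj₂ (inj₂ b₂x))  (inj₂ ())
      sorted (inj₂ (inj₂ xy))   (inj₁ ())
      sorted (inj₂ (inj₂ xy))   (inj₂ ())

  side₂ : Attachment G₂ glued F₂ x₂ a₂ b₂ c₂ N₂.ea N₂.eb N₂.ec
  side₂ = record
    { place = in₂ ; inner = inj₂ ∘ inj₁ ; ca = new a₂y ; cb = new b₂x ; cc = new c₁c₂
    ; unlift = unlift ; unlift-inner = λ _ → refl ; unlift-a = refl ; unlift-b = refl ; unlift-c = refl
    ; inner-at = inner-at ; ca-at = inj₁ refl ; cb-at = inj₁ refl ; cc-at = inj₂ refl
    ; classify = classify }
    where
    unlift : Edge → E G₂
    unlift (inj₂ (inj₁ (e , _))) = e
    unlift (inj₂ (inj₂ a₂y))     = N₂.ea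
    unlift (inj₂ (inj₂ b₂x))     = N₂.eb
    unlift (inj₂ (inj₂ c₁c₂))    = N₂.ec
    unlift _                     = N₂.ea
    inner-at : ∀ {v} i → Incident G₂ (proj₁ i) v → Incident glued (inj₂ (inj₁ i)) (in₂ v)
    inner-at (e , p , q) (inj₁ refl) = inj₁ (sym (in₂-inside p))
    inner-at (e , p , q) (inj₂ refl) = inj₂ (sym (in₂-inside q))
    classify : ∀ {v} → v ≢ x₂ → ∀ f → Incident glued f (in₂ v) →
               Origin G₂ glued F₂ x₂ a₂ b₂ c₂ (inj₂ ∘ inj₁) (new a₂y) (new b₂x) (new c₁c₂) v f
    classify {v} v≢x₂ f i = sorted f (subst (Incident glued f) (in₂-inside p) i)
      where
      p : False (decV F₂ v x₂)
      p = fromWitnessFalse v≢x₂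
      sorted : ∀ f → Incident glued f (inj₂ (inj₁ (v , p))) →
               Origin G₂ glued F₂ x₂ a₂ b₂ c₂ (inj₂ ∘ inj₁) (new a₂y) (new b₂x) (new c₁c₂) v f
      sorted (inj₂ (inj₁ j))    (inj₁ r) = inj₁ (j , refl , inj₁ (cong proj₁ (inj₁-injective (inj₂-injective r))))
      sorted (inj₂ (inj₁ j))    (inj₂ r) = inj₁ (j , refl , inj₂ (cong proj₁ (inj₁-injective (inj₂-injective r))))
      sorted (inj₁ _)           (inj₁ ())
      sorted (inj₁ _)           (inj₂ ())
      sorted (inj₂ (inj₂ a₂y))  (inj₁ r) = inj₂ (inj₁ (refl , sym (in₂-injective r)))
      sorted (inj₂ (inj₂ a₂y))  (inj₂ ())
      sorted (inj₂ (inj₂ b₂x))  (inj₁ r) = inj₂ (inj₂ (inj₁ (refl , sym (in₂-injective r))))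
      sorted (inj₂ (inj₂ b₂x))  (inj₂ ())
      sorted (inj₂ (inj₂ c₁c₂)) (inj₂ r) = inj₂ (inj₂ (inj₂ (refl , sym (in₂-injective r))))
      sorted (inj₂ (inj₂ c₁c₂)) (inj₁ r) = ⊥-elim (in₁-not-right r)
      sorted (inj₂ (inj₂ a₁y))  (inj₁ r) = ⊥-elim (in₁-not-right r)
      sorted (inj₂ (inj₂ a₁y))  (inj₂ ())
      sorted (inj₂ (inj₂ b₁x))  (inj₁ r) = ⊥-elim (in₁-not-right r)
      sorted (inj₂ (inj₂ b₁x))  (inj₂ ())
      sorted (inj₂ (inj₂ xy))   (inj₁ ())
      sorted (inj₂ (inj₂ xy))   (inj₂ ())

  star-x : IsStar glued X (new b₁x) (new b₂x) (new xy)
  star-x = record { h₁≢h₂ = λ () ; h₁≢h₃ = λ () ; h₂≢h₃ = λ ()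
                  ; at₁ = inj₂ refl ; at₂ = inj₂ refl ; at₃ = inj₁ refl ; only = only }
    where
    only : ∀ f → Incident glued f X → In3 f (new b₁x) (new b₂x) (new xy)
    only (inj₁ _)           (inj₁ ())
    only (inj₁ _)           (inj₂ ())
    only (inj₂ (inj₁ _))    (inj₁ ())
    only (inj₂ (inj₁ _))    (inj₂ ())
    only (inj₂ (inj₂ b₁x))  _        = inj₁ refl
    only (inj₂ (inj₂ b₂x))  _        = inj₂ (inj₁ refl)
    only (inj₂ (inj₂ xy))   _        = inj₂ (inj₂ refl)
    only (inj₂ (inj₂ c₁c₂)) (inj₁ r) = ⊥-elim (in₁-not-new N₁.c≢x r)
    only (inj₂ (inj₂ c₁c₂)) (inj₂ r) = ⊥-elim (in₂-not-new N₂.c≢x r)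
    only (inj₂ (inj₂ a₁y))  (inj₁ r) = ⊥-elim (in₁-not-new N₁.a≢x r)
    only (inj₂ (inj₂ a₁y))  (inj₂ ())
    only (inj₂ (inj₂ a₂y))  (inj₁ r) = ⊥-elim (in₂-not-new N₂.a≢x r)
    only (inj₂ (inj₂ a₂y))  (inj₂ ())

  star-y : IsStar glued Y (new a₁y) (new a₂y) (new xy)
  star-y = record { h₁≢h₂ = λ () ; h₁≢h₃ = λ () ; h₂≢h₃ = λ ()
                  ; at₁ = inj₂ refl ; at₂ = inj₂ refl ; at₃ = inj₂ refl ; only = only }
    where
    only : ∀ f → Incident glued f Y → In3 f (new a₁y) (new a₂y) (new xy)
    only (inj₁ _)           (inj₁ ())
    only (inj₁ _)           (inj₂ ())
    only (inj₂ (inj₁ _))    (inj₁ ())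
    only (inj₂ (inj₁ _))    (inj₂ ())
    only (inj₂ (inj₂ a₁y))  _        = inj₁ refl
    only (inj₂ (inj₂ a₂y))  _        = inj₂ (inj₁ refl)
    only (inj₂ (inj₂ xy))   _        = inj₂ (inj₂ refl)
    only (inj₂ (inj₂ c₁c₂)) (inj₁ r) = ⊥-elim (in₁-not-new N₁.c≢x r)
    only (inj₂ (inj₂ c₁c₂)) (inj₂ r) = ⊥-elim (in₂-not-new N₂.c≢x r)
    only (inj₂ (inj₂ b₁x))  (inj₁ r) = ⊥-elim (in₁-not-new N₁.b≢x r)
    only (inj₂ (inj₂ b₁x))  (inj₂ ())
    only (inj₂ (inj₂ b₂x))  (inj₁ r) = ⊥-elim (in₂-not-new N₂.b≢x r)
    only (inj₂ (inj₂ b₂x))  (inj₂ ())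

  module S₁ = Side F₁ cubic₁ N₁.starX (Attached.embedding cubic₁ nb₁ side₁)
  module S₂ = Side F₂ cubic₂ N₂.starX (Attached.embedding cubic₂ nb₂ side₂)
  open Counting {glued}

  c₁c₂-count : ∀ Ms → count glued (new xy) Ms ℕ.+ S₁.#full Ms ℕ.+ S₂.#full Ms ≤ count glued (new c₁c₂) Ms
  c₁c₂-count Ms = begin
    count glued (new xy) Ms ℕ.+ S₁.#full Ms ℕ.+ S₂.#full Ms
      ≡⟨ cong (λ n → n ℕ.+ S₁.#full Ms ℕ.+ S₂.#full Ms) (count-sum (new xy) Ms) ⟩
    Σℕ⟨ Ms ⟩ (uses xy) ℕ.+ S₁.#full Ms ℕ.+ S₂.#full Ms
      ≡⟨ sym (Σℕ-+₃ Ms (uses xy) (ind ∘ S₁.full) (ind ∘ S₂.full)) ⟩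
    Σℕ⟨ Ms ⟩ (λ M → uses xy M ℕ.+ ind (S₁.full M) ℕ.+ ind (S₂.full M))
      ≤⟨ Σℕ-mono Ms (λ M@(_ , pm) → c₁c₂-carries (Matchings.matching-at-star pm star-y)
                                    (Matchings.matching-at-star pm star-x) (S₁.cut-parity M) (S₂.cut-parity M)) ⟩
    Σℕ⟨ Ms ⟩ (uses c₁c₂)
      ≡⟨ sym (count-sum (new c₁c₂) Ms) ⟩
    count glued (new c₁c₂) Ms ∎
    where
    open ℕₚ.≤-Reasoning
    uses : NewEdge → PerfectMatching glued → ℕ
    uses e M = ind (proj₁ M (new e))

  -- τ(G) ≥ 5: a small covering restricts to one side unless both sides have matchings using
  -- the whole cut; then c₁c₂ is used at least three times, plus two more matchings at c₁
  τ≥5 : TauAtLeast5 G₁ → TauAtLeast5 G₂ → TauAtLeast5 glued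
  τ≥5 τ₁ τ₂ Ms cover with S₁.#full Ms ℕ.≟ 0 | S₂.#full Ms ℕ.≟ 0
  ... | yes none | _ = let Ns , cover′ , same = S₁.covering-restricts Ms cover none in subst (5 ≤_) same (τ₁ Ns cover′)
  ... | no _ | yes none = let Ns , cover′ , same = S₂.covering-restricts Ms cover none in subst (5 ≤_) same (τ₂ Ns cover′)
  ... | no some₁ | no some₂ = begin
    3 ℕ.+ 2                       ≤⟨ ℕₚ.+-monoˡ-≤ 2 three ⟩
    count glued (new c₁c₂) Ms ℕ.+ 2 ≤⟨ S₁.cut-bound Ms (λ _ → used _) N₁.c≢x N₁.ec-at-c ⟩
    length Ms                     ∎
    where
    open ℕₚ.≤-Reasoning
    used : ∀ f → 1 ≤ count glued f Ms
    used f = covered⇒count f Ms (cover f)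
    three : 3 ≤ count glued (new c₁c₂) Ms
    three = ℕₚ.≤-trans (ℕₚ.+-mono-≤ (ℕₚ.+-mono-≤ (used (new xy)) (ℕₚ.n≢0⇒n>0 some₁)) (ℕₚ.n≢0⇒n>0 some₂))
                       (c₁c₂-count Ms)

  -- τ_odd(G) ≠ 5: as above, but now each side has evenly many (so at least two) matchings
  -- using the whole cut, so c₁c₂ is used five times and seven matchings would be needed
  τodd≢5 : TauAtLeast5 G₁ → TauAtLeast5 G₂ → ¬ TauOddIs5 G₁ → ¬ TauOddIs5 G₂ → ¬ TauOddIs5 glued
  τodd≢5 τ₁ τ₂ ¬five₁ ¬five₂ ((Ms , odd , five) , _) with S₁.#full Ms ℕ.≟ 0 | S₂.#full Ms ℕ.≟ 0
  ... | yes none | _ = let Ns , odd′ , same = S₁.odd-covering-restricts Ms odd none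
                       in ¬five₁ (Counting.odd-five τ₁ Ns odd′ (trans same five))
  ... | no _ | yes none = let Ns , odd′ , same = S₂.odd-covering-restricts Ms odd none
                          in ¬five₂ (Counting.odd-five τ₂ Ns odd′ (trans same five))
  ... | no some₁ | no some₂ = 7≰5 (begin
    5 ℕ.+ 2                         ≤⟨ ℕₚ.+-monoˡ-≤ 2 five-uses ⟩
    count glued (new c₁c₂) Ms ℕ.+ 2 ≤⟨ S₁.cut-bound Ms (λ _ → used _) N₁.c≢x N₁.ec-at-c ⟩
    length Ms                       ≡⟨ five ⟩
    5                               ∎)
    where
    open ℕₚ.≤-Reasoning
    used : ∀ f → 1 ≤ count glued f Ms
    used f = odd⇒positive _ (odd f)
    at-least-two : ∀ {n} → n ≢ 0 → parity n ≡ 0ℙ → 2 ≤ n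
    at-least-two {suc (suc _)} _ _ = s≤s (s≤s z≤n)
    at-least-two {zero} n≢0 _ = ⊥-elim (n≢0 refl)
    five-uses : 5 ≤ count glued (new c₁c₂) Ms
    five-uses = ℕₚ.≤-trans (ℕₚ.+-mono-≤ (ℕₚ.+-mono-≤ (used (new xy)) (at-least-two some₁ (S₁.full-even Ms odd five)))
                                                      (at-least-two some₂ (S₂.full-even Ms odd five)))
                           (c₁c₂-count Ms)
    7≰5 : ¬ 7 ≤ 5
    7≰5 (s≤s (s≤s (s≤s (s≤s (s≤s ())))))

proposition6p6 : (G₁ G₂ : Graph) (F₁ : Finite G₁) (F₂ : Finite G₂)
    (x₁ a₁ b₁ c₁ : V G₁) (x₂ a₂ b₂ c₂ : V G₂) →
    Cubic G₁ → Bridgeless G₁ → NeighboursAre G₁ x₁ a₁ b₁ c₁ →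
    TauAtLeast5 G₁ → ¬ TauOddIs5 G₁ →
    Cubic G₂ → Bridgeless G₂ → NeighboursAre G₂ x₂ a₂ b₂ c₂ →
    TauAtLeast5 G₂ → ¬ TauOddIs5 G₂ →
    TauAtLeast5 (glue G₁ G₂ F₁ F₂ x₁ a₁ b₁ c₁ x₂ a₂ b₂ c₂)
      × (HasOddCovering (glue G₁ G₂ F₁ F₂ x₁ a₁ b₁ c₁ x₂ a₂ b₂ c₂) →
         ¬ TauOddIs5 (glue G₁ G₂ F₁ F₂ x₁ a₁ b₁ c₁ x₂ a₂ b₂ c₂))
proposition6p6 G₁ G₂ F₁ F₂ x₁ a₁ b₁ c₁ x₂ a₂ b₂ c₂ cubic₁ _ nb₁ τ₁ ¬five₁ cubic₂ _ nb₂ τ₂ ¬five₂ =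
  τ≥5 τ₁ τ₂ , λ _ → τodd≢5 τ₁ τ₂ ¬five₁ ¬five₂
  where open Glued G₁ G₂ F₁ F₂ x₁ a₁ b₁ c₁ x₂ a₂ b₂ c₂ cubic₁ nb₁ cubic₂ nb₂
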